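{- Fix integers $t\geq 1$ and $m\geq 1$. Every $x\in\Lambda\cap C_m$ can be written uniquely as $x=\sum_{i=0}^t c_i v_{m+i}$ with integers $c_i\geq 0$ and $c_0\geq 1$. Define $f(x)$ to be the partition in which, for each $i\in\{0,\dots,t\}$, the part $m+i$ appears with multiplicity $c_i$ (and no other parts appear). Then $f$ is a bijection from $\Lambda\cap C_m$ onto $\tilde{C}_m$, and it is height-preserving: $|f(x)|=x_0+x_1+\cdots+x_t$ for all $x\in\Lambda\cap C_m$.
   Context: Coordinates of $\mathbb{R}^{t+1}$ are indexed $x=(x_0,\dots,x_t)$. Let $\Lambda=\mathbb{Z}^t\times t\mathbb{Z}$, the integer points whose last coordinate is divisible by $t$. For $j\in\{0,\dots,t-1\}$ let $b_j\in\mathbb{R}^t$ be the vector whose first $j+1$ entries are $1$ and remaining entries $0$. For $i\geq 1$ define $v_i\in\mathbb{Z}^{t+1}$ as the vector whose first $t$ coordinates are $b_{(i-1)\bmod t}$ and whose last coordinate is $t\lfloor (i-1)/t\rfloor$. For $m\geq 1$ let $C_m=\{\sum_{i=0}^t \alpha_i v_{m+i} : \alpha_i\in\mathbb{R},\ \alpha_i\geq 0,\ \alpha_0>0\}$. Let $\tilde{C}_m$ be the set of partitions whose smallest part is exactly $m$ and whose largest part minus smallest part is at most $t$. For a partition $\lambda$, $|\lambda|$ denotes the sum of its parts.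
   Formalization: The coefficients $\alpha_i$ in the definition of the cone $C_m$ range over the rationals rather than the reals. -}

module Defs where

open import Data.Bool using (Bool; true; false; if_then_else_)
open import Data.Nat as ℕ using (ℕ; zero; suc; _∸_; NonZero; _≤ᵇ_; _<ᵇ_)
open import Data.Nat.DivMod using (_/_; _%_)
open import Data.Integer as ℤ using (ℤ; +_)
open import Data.Integer.Divisibility as ℤD using ()
open import Data.Rational as ℚ using (ℚ; 0ℚ)
open import Data.Fin using (Fin; zero; suc; toℕ; fromℕ)
open import Data.List as L using (List; []; _∷_)
open import Data.List.Relation.Unary.All using (All)
open import Data.List.Membership.Propositional using (_∈_)
open import Data.List.Relation.Unary.Linked using (Linked)
open import Data.Nat.ListAction using (sum)
open import Data.Product using (Σ; _×_)
open import Relation.Binary.PropositionalEquality using (_≡_)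

-- Points of ℤ^{t+1}, coordinates x_0 … x_t (index fromℕ t is the last one).
Pt : ℕ → Set
Pt t = Fin (suc t) → ℤ

Σℤ : ∀ {n} → (Fin n → ℤ) → ℤ
Σℤ f = L.foldr ℤ._+_ (+ 0) (L.tabulate f)

Σℚ : ∀ {n} → (Fin n → ℚ) → ℚ
Σℚ f = L.foldr ℚ._+_ 0ℚ (L.tabulate f)

v : (t : ℕ) → .{{NonZero t}} → ℕ → Pt t
v t i j =
  if toℕ j <ᵇ t
  then (if toℕ j ≤ᵇ ((i ∸ 1) % t) then + 1 else + 0)
  else + (t ℕ.* ((i ∸ 1) / t))

InΛ : (t : ℕ) → Pt t → Set
InΛ t x = (+ t) ℤD.∣ x (fromℕ t)

toℚ : ℤ → ℚ
toℚ z = z ℚ./ 1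

InC : (t : ℕ) → .{{NonZero t}} → (m : ℕ) → Pt t → Set
InC t m x = Σ (Fin (suc t) → ℚ) λ α →
  ((i : Fin (suc t)) → 0ℚ ℚ.≤ α i) × (0ℚ ℚ.< α zero) ×
  ((j : Fin (suc t)) → toℚ (x j) ≡ Σℚ (λ i → α i ℚ.* toℚ (v t (m ℕ.+ toℕ i) j)))

IntRep : (t : ℕ) → .{{NonZero t}} → (m : ℕ) → Pt t → (Fin (suc t) → ℕ) → Set
IntRep t m x c = (1 ℕ.≤ c zero) ×
  ((j : Fin (suc t)) → x j ≡ Σℤ (λ i → (+ c i) ℤ.* v t (m ℕ.+ toℕ i) j))

IsPartition : List ℕ → Set
IsPartition lam = All (λ p → 1 ℕ.≤ p) lam × Linked ℕ._≥_ lam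

∣_∣ₚ : List ℕ → ℕ
∣ lam ∣ₚ = sum lam

InCt : (t m : ℕ) → List ℕ → Set
InCt t m lam = IsPartition lam × (m ∈ lam) × All (λ p → m ℕ.≤ p × p ℕ.≤ m ℕ.+ t) lam

partOf : (t m : ℕ) → (Fin (suc t) → ℕ) → List ℕ
partOf t m c = L.concatMap (λ i → L.replicate (c i) (m ℕ.+ toℕ i)) (L.reverse (L.allFin (suc t)))

{-# OPTIONS --safe #-}
module Submission where

-- For each i ≤ t there is an integral linear functional φᵢ with φᵢ(v_{m+k}) = t·δᵢₖ and
-- φᵢ(Λ) ⊆ tℤ. It combines two prefix coordinates x_a − x_b, which detect the residue
-- (n − 1) mod t that determines the first t entries of v_n, with the last coordinate, which
-- records t·⌊(n − 1)/t⌋. Applying φᵢ to x = Σ αₖ v_{m+k} gives t·αᵢ, so the coefficients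
-- of a point of C_m are unique, and integral when the point lies in Λ. On the partition
-- side, weakly decreasing lists with parts in [m, m + t] correspond exactly to multiplicity
-- vectors, and heights match because the coordinates of v_n sum to n.

open import Algebra.Bundles using (CommutativeRing)
import Algebra.Properties.CommutativeSemigroup as CommutativeSemigroupProperties
import Algebra.Properties.Semiring.Sum as SemiringSum
open import Data.Bool as Bool using (true; false; if_then_else_)
open import Data.Fin using (Fin; zero; suc; toℕ; fromℕ; fromℕ<; inject₁; punchIn)
import Data.Fin.Properties as FinP
open import Data.Integer as ℤ using (ℤ; +_; -[1+_]; 0ℤ; 1ℤ; -1ℤ)
import Data.Integer.Divisibility.Signed as ℤ∣
import Data.Integer.Properties as ℤP
open import Data.Integer.Tactic.RingSolver using (solve-∀)
open import Data.List as L using (List; []; _∷_; _++_; [_])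
open import Data.List.Membership.Propositional using (_∈_)
open import Data.List.Membership.Propositional.Properties using (∈-++⁺ʳ; ∈-++⁻)
import Data.List.Properties as LP
open import Data.List.Relation.Unary.All as All using (All; []; _∷_)
import Data.List.Relation.Unary.All.Properties as AllP
open import Data.List.Relation.Unary.Any using (here; there)
open import Data.List.Relation.Unary.Linked as Linked using (Linked; []; [-]; _∷_)
open import Data.List.Relation.Unary.Linked.Properties using (Linked⇒All)
open import Data.Nat as ℕ using (ℕ; zero; suc; NonZero; _≤_; _<_; z≤n; s≤s; _∸_)
import Data.Nat.Coprimality as Coprimality
open import Data.Nat.Divisibility using (n∣m*n)
open import Data.Nat.DivMod
open import Data.Nat.ListAction using (sum)
open import Data.Nat.ListAction.Properties using (sum-++)
import Data.Nat.Properties as ℕP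
open import Data.Product as Product using (Σ; ∃; ∃₂; _×_; _,_; proj₁; proj₂)
open import Data.Rational as ℚ using (ℚ; mkℚ; 0ℚ)
import Data.Rational.Properties as ℚP
open import Data.Sum using (inj₁; inj₂)
import Data.Vec.Functional as VF
import Data.Vec.Functional.Properties as VFP
open import Function using (_∘_; id)
open import Relation.Binary.Definitions using (tri<; tri≈; tri>)
open import Relation.Binary.PropositionalEquality using (_≡_; _≢_; refl; sym; trans; cong; cong₂; subst; module ≡-Reasoning)
open import Relation.Nullary using (¬_; yes; no; contradiction)

open import Defs

open CommutativeSemigroupProperties ℕP.+-commutativeSemigroup using (xy∙z≈xz∙y)
module ℚ* = CommutativeSemigroupProperties (CommutativeRing.*-commutativeSemigroup ℚP.+-*-commutativeRing)

module ℕΣ = SemiringSum ℕP.+-*-semiring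
module ℤΣ = SemiringSum ℤP.+-*-semiring
module ℚΣ = SemiringSum (CommutativeRing.semiring ℚP.+-*-commutativeRing)

Σℤ≡sum : ∀ {n} (f : Fin n → ℤ) → Σℤ f ≡ ℤΣ.sum f
Σℤ≡sum {zero}  f = refl
Σℤ≡sum {suc n} f = cong (ℤ._+_ (f zero)) (Σℤ≡sum (f ∘ suc))

Σℚ≡sum : ∀ {n} (f : Fin n → ℚ) → Σℚ f ≡ ℚΣ.sum f
Σℚ≡sum {zero}  f = refl
Σℚ≡sum {suc n} f = cong (f zero ℚ.+_) (Σℚ≡sum (f ∘ suc))

sum-supported-at : ∀ {n} (f : Fin (suc n) → ℚ) i → (∀ k → k ≢ i → f k ≡ 0ℚ) → ℚΣ.sum f ≡ f i
sum-supported-at {n} f i f≡0 = begin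
  ℚΣ.sum f                             ≡⟨ ℚΣ.sum-remove f ⟩
  f i ℚ.+ ℚΣ.sum (f ∘ punchIn i)       ≡⟨ cong (f i ℚ.+_) (ℚΣ.sum-cong-≗ (λ k → f≡0 _ (FinP.punchInᵢ≢i i k))) ⟩
  f i ℚ.+ ℚΣ.sum {n} (λ _ → 0ℚ)        ≡⟨ cong (f i ℚ.+_) (ℚΣ.sum-replicate-zero n) ⟩
  f i ℚ.+ 0ℚ                           ≡⟨ ℚP.+-identityʳ (f i) ⟩
  f i                                  ∎
  where open ≡-Reasoning

Σℤ-cong : ∀ {n} {f g : Fin n → ℤ} → (∀ i → f i ≡ g i) → Σℤ f ≡ Σℤ g
Σℤ-cong eq = cong (L.foldr ℤ._+_ 0ℤ) (LP.tabulate-cong eq)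

Σℚ-cong : ∀ {n} {f g : Fin n → ℚ} → (∀ i → f i ≡ g i) → Σℚ f ≡ Σℚ g
Σℚ-cong eq = cong (L.foldr ℚ._+_ 0ℚ) (LP.tabulate-cong eq)

pos-sum : ∀ {n} (f : Fin n → ℕ) → + ℕΣ.sum f ≡ ℤΣ.sum (+_ ∘ f)
pos-sum {zero}  f = refl
pos-sum {suc n} f = trans (ℤP.pos-+ (f zero) _) (cong (ℤ._+_ (+ f zero)) (pos-sum (f ∘ suc)))

Σℤ-∣ : ∀ {n k} (f : Fin n → ℤ) → (∀ i → k ℤ∣.∣ f i) → k ℤ∣.∣ Σℤ f
Σℤ-∣ {zero}  {k} f _  = ℤ∣.divides 0ℤ (sym (ℤP.*-zeroˡ k))
Σℤ-∣ {suc n}     f k∣ = ℤ∣.∣m∣n⇒∣m+n (k∣ zero) (Σℤ-∣ (f ∘ suc) (k∣ ∘ suc))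

neg-distrib-sum : ∀ {n} (f : Fin n → ℚ) → ℚ.- ℚΣ.sum f ≡ ℚΣ.sum (ℚ.-_ ∘ f)
neg-distrib-sum {zero}  f = refl
neg-distrib-sum {suc n} f = trans (ℚP.neg-distrib-+ (f zero) _) (cong (ℚ.- f zero ℚ.+_) (neg-distrib-sum (f ∘ suc)))

coprime-1 : ∀ z → Coprimality.Coprime ℤ.∣ z ∣ 1
coprime-1 z = Coprimality.sym (Coprimality.1-coprimeTo ℤ.∣ z ∣)

-- toℚ z = z / 1 goes through normalisation; every fact about toℚ is read off this normal form.
toℚ≡mkℚ : ∀ z → toℚ z ≡ mkℚ z 0 (coprime-1 z)
toℚ≡mkℚ (+ n)    = ℚP.normalize-coprime (coprime-1 (+ n))
toℚ≡mkℚ -[1+ n ] = cong ℚ.-_ (ℚP.normalize-coprime (coprime-1 (+ suc n)))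

toℚ-injective : ∀ {a b} → toℚ a ≡ toℚ b → a ≡ b
toℚ-injective {a} {b} eq rewrite toℚ≡mkℚ a | toℚ≡mkℚ b = cong ℚ.↥_ eq

toℚ-+ : ∀ a b → toℚ (a ℤ.+ b) ≡ toℚ a ℚ.+ toℚ b
toℚ-+ a b rewrite toℚ≡mkℚ a | toℚ≡mkℚ b =
  cong (ℚ._/ 1) (sym (cong₂ ℤ._+_ (ℤP.*-identityʳ a) (ℤP.*-identityʳ b)))

toℚ-* : ∀ a b → toℚ (a ℤ.* b) ≡ toℚ a ℚ.* toℚ b
toℚ-* a b rewrite toℚ≡mkℚ a | toℚ≡mkℚ b = refl

toℚ-neg : ∀ a → toℚ (ℤ.- a) ≡ ℚ.- toℚ a
toℚ-neg (+ zero)  = refl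
toℚ-neg (+ suc n) rewrite toℚ≡mkℚ (+ suc n) = refl
toℚ-neg -[1+ n ]  rewrite toℚ≡mkℚ (+ suc n) = refl

toℚ-- : ∀ a b → toℚ (a ℤ.- b) ≡ toℚ a ℚ.- toℚ b
toℚ-- a b = trans (toℚ-+ a (ℤ.- b)) (cong (toℚ a ℚ.+_) (toℚ-neg b))

toℚ-nonNegative : ∀ n → 0ℚ ℚ.≤ toℚ (+ n)
toℚ-nonNegative n rewrite toℚ≡mkℚ (+ n) = ℚP.nonNegative⁻¹ _

toℚ-positive : ∀ {n} → 1 ≤ n → 0ℚ ℚ.< toℚ (+ n)
toℚ-positive {suc n} _ rewrite toℚ≡mkℚ (+ suc n) = ℚP.positive⁻¹ _

toℚ-nonNegative⁻ : ∀ z → 0ℚ ℚ.≤ toℚ z → 0ℤ ℤ.≤ z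
toℚ-nonNegative⁻ z p rewrite toℚ≡mkℚ z = subst (0ℤ ℤ.≤_) (ℤP.*-identityʳ z) (ℚP.drop-*≤* p)

toℚ-positive⁻ : ∀ z → 0ℚ ℚ.< toℚ z → 0ℤ ℤ.< z
toℚ-positive⁻ z p rewrite toℚ≡mkℚ z = subst (0ℤ ℤ.<_) (ℤP.*-identityʳ z) (ℚP.drop-*<* p)

toℚ-*-cancelʳ : ∀ n {p q} → p ℚ.* toℚ (+ suc n) ≡ q ℚ.* toℚ (+ suc n) → p ≡ q
toℚ-*-cancelʳ n eq rewrite toℚ≡mkℚ (+ suc n) =
  ℚP.≤-antisym (ℚP.*-cancelʳ-≤-pos _ (ℚP.≤-reflexive eq)) (ℚP.*-cancelʳ-≤-pos _ (ℚP.≤-reflexive (sym eq)))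

toℚ-Σ-* : ∀ {n} (a b : Fin n → ℤ) → toℚ (Σℤ (λ i → a i ℤ.* b i)) ≡ Σℚ (λ i → toℚ (a i) ℚ.* toℚ (b i))
toℚ-Σ-* {zero}  a b = refl
toℚ-Σ-* {suc n} a b = begin
  toℚ (a zero ℤ.* b zero ℤ.+ Σℤ (λ i → a (suc i) ℤ.* b (suc i)))        ≡⟨ toℚ-+ (a zero ℤ.* b zero) _ ⟩
  toℚ (a zero ℤ.* b zero) ℚ.+ toℚ (Σℤ (λ i → a (suc i) ℤ.* b (suc i)))  ≡⟨ cong₂ ℚ._+_ (toℚ-* (a zero) (b zero)) (toℚ-Σ-* (a ∘ suc) (b ∘ suc)) ⟩
  toℚ (a zero) ℚ.* toℚ (b zero) ℚ.+ Σℚ (λ i → toℚ (a (suc i)) ℚ.* toℚ (b (suc i))) ∎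
  where open ≡-Reasoning

record Linear {n} (f : (Fin n → ℚ) → ℚ) : Set where
  field
    linearity : ∀ {k} (β : Fin k → ℚ) (w : Fin k → Fin n → ℚ) y →
      (∀ j → y j ≡ ℚΣ.sum (λ i → β i ℚ.* w i j)) → f y ≡ ℚΣ.sum (λ i → β i ℚ.* f (w i))
open Linear

+-linear : ∀ {n} {f g : (Fin n → ℚ) → ℚ} → Linear f → Linear g → Linear (λ y → f y ℚ.+ g y)
linearity (+-linear {f = f} {g} f-lin g-lin) β w y y≡ = begin
  f y ℚ.+ g y                                                       ≡⟨ cong₂ ℚ._+_ (linearity f-lin β w y y≡) (linearity g-lin β w y y≡) ⟩
  ℚΣ.sum (λ i → β i ℚ.* f (w i)) ℚ.+ ℚΣ.sum (λ i → β i ℚ.* g (w i))  ≡⟨ ℚΣ.∑-distrib-+ (λ i → β i ℚ.* f (w i)) (λ i → β i ℚ.* g (w i)) ⟨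
  ℚΣ.sum (λ i → β i ℚ.* f (w i) ℚ.+ β i ℚ.* g (w i))                 ≡⟨ ℚΣ.sum-cong-≗ (λ i → ℚP.*-distribˡ-+ (β i) _ _) ⟨
  ℚΣ.sum (λ i → β i ℚ.* (f (w i) ℚ.+ g (w i)))                       ∎
  where open ≡-Reasoning

neg-linear : ∀ {n} {f : (Fin n → ℚ) → ℚ} → Linear f → Linear (λ y → ℚ.- f y)
linearity (neg-linear {f = f} f-lin) β w y y≡ = begin
  ℚ.- f y                                  ≡⟨ cong ℚ.-_ (linearity f-lin β w y y≡) ⟩
  ℚ.- ℚΣ.sum (λ i → β i ℚ.* f (w i))        ≡⟨ neg-distrib-sum (λ i → β i ℚ.* f (w i)) ⟩
  ℚΣ.sum (λ i → ℚ.- (β i ℚ.* f (w i)))      ≡⟨ ℚΣ.sum-cong-≗ (λ i → ℚP.neg-distribʳ-* (β i) _) ⟩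
  ℚΣ.sum (λ i → β i ℚ.* ℚ.- f (w i))        ∎
  where open ≡-Reasoning

*-linear : ∀ {n} {f : (Fin n → ℚ) → ℚ} c → Linear f → Linear (λ y → c ℚ.* f y)
linearity (*-linear {f = f} c f-lin) β w y y≡ = begin
  c ℚ.* f y                                 ≡⟨ cong (c ℚ.*_) (linearity f-lin β w y y≡) ⟩
  c ℚ.* ℚΣ.sum (λ i → β i ℚ.* f (w i))      ≡⟨ ℚΣ.*-distribˡ-sum c (λ i → β i ℚ.* f (w i)) ⟩
  ℚΣ.sum (λ i → c ℚ.* (β i ℚ.* f (w i)))    ≡⟨ ℚΣ.sum-cong-≗ (λ i → ℚ*.x∙yz≈y∙xz c (β i) _) ⟩
  ℚΣ.sum (λ i → β i ℚ.* (c ℚ.* f (w i)))    ∎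
  where open ≡-Reasoning

sub-linear : ∀ {n} {f g : (Fin n → ℚ) → ℚ} → Linear f → Linear g → Linear (λ y → f y ℚ.- g y)
sub-linear {g = g} f-lin g-lin = +-linear {g = λ y → ℚ.- g y} f-lin (neg-linear g-lin)

coordinate-linear : ∀ {n} (j : Fin n) → Linear (λ y → y j)
linearity (coordinate-linear j) β w y y≡ = y≡ j

divMod-unique : ∀ {n d ρ Q} .{{_ : NonZero d}} → n ≡ ρ ℕ.+ Q ℕ.* d → ρ < d → n % d ≡ ρ × n / d ≡ Q
divMod-unique {d = d} {ρ} {Q} refl ρ<d =
  trans ([m+kn]%n≡m%n ρ Q d) (m<n⇒m%n≡m ρ<d) ,
  trans (+-distrib-/-∣ʳ ρ (n∣m*n Q)) (cong₂ ℕ._+_ (m<n⇒m/n≡0 ρ<d) (m*n/n≡m Q d))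

data Shift (n k d : ℕ) .{{_ : NonZero d}} : Set where
  stays : (n ℕ.+ k) % d ≡ n % d ℕ.+ k → (n ℕ.+ k) / d ≡ n / d → Shift n k d
  wraps : (n ℕ.+ k) % d ℕ.+ d ≡ n % d ℕ.+ k → (n ℕ.+ k) / d ≡ suc (n / d) → Shift n k d

shift : ∀ n k d .{{_ : NonZero d}} → k ≤ d → Shift n k d
shift n k d k≤d with n % d ℕ.+ k ℕ.<? d
... | yes r+k<d = stays (proj₁ dm) (proj₂ dm)
  where
  n+k≡ : n ℕ.+ k ≡ (n % d ℕ.+ k) ℕ.+ n / d ℕ.* d
  n+k≡ = trans (cong (ℕ._+ k) (m≡m%n+[m/n]*n n d)) (xy∙z≈xz∙y (n % d) (n / d ℕ.* d) k)
  dm = divMod-unique n+k≡ r+k<d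
... | no r+k≮d = wraps (trans (cong (ℕ._+ d) (proj₁ dm)) (ℕP.m∸n+n≡m d≤r+k)) (proj₂ dm)
  where
  d≤r+k = ℕP.≮⇒≥ r+k≮d
  ρ = n % d ℕ.+ k ∸ d
  ρ<d : ρ < d
  ρ<d = ℕP.+-cancelʳ-< _ _ d (subst (_< d ℕ.+ d) (sym (ℕP.m∸n+n≡m d≤r+k)) (ℕP.+-mono-<-≤ (m%n<n n d) k≤d))
  n+k≡ : n ℕ.+ k ≡ ρ ℕ.+ suc (n / d) ℕ.* d
  n+k≡ = begin
    n ℕ.+ k                           ≡⟨ cong (ℕ._+ k) (m≡m%n+[m/n]*n n d) ⟩
    n % d ℕ.+ n / d ℕ.* d ℕ.+ k       ≡⟨ xy∙z≈xz∙y (n % d) (n / d ℕ.* d) k ⟩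
    n % d ℕ.+ k ℕ.+ n / d ℕ.* d       ≡⟨ cong (ℕ._+ n / d ℕ.* d) (ℕP.m∸n+n≡m d≤r+k) ⟨
    ρ ℕ.+ d ℕ.+ n / d ℕ.* d           ≡⟨ ℕP.+-assoc ρ d (n / d ℕ.* d) ⟩
    ρ ℕ.+ suc (n / d) ℕ.* d           ∎
    where open ≡-Reasoning
  dm = divMod-unique n+k≡ ρ<d

sum-replicate : ∀ k x → sum (L.replicate k x) ≡ k ℕ.* x
sum-replicate zero    x = refl
sum-replicate (suc k) x = cong (x ℕ.+_) (sum-replicate k x)

∈-replicate⁻ : ∀ k {x y : ℕ} → y ∈ L.replicate k x → y ≡ x
∈-replicate⁻ (suc k) (here y≡x) = y≡x
∈-replicate⁻ (suc k) (there y∈) = ∈-replicate⁻ k y∈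

replicate-++-sorted : ∀ k {x xs} → All (_≤ x) xs → Linked ℕ._≥_ xs → Linked ℕ._≥_ (L.replicate k x ++ xs)
replicate-++-sorted zero          _          sorted = sorted
replicate-++-sorted (suc zero)    []         _      = [-]
replicate-++-sorted (suc zero)    (y≤x ∷ _)  sorted = y≤x ∷ sorted
replicate-++-sorted (suc (suc k)) below      sorted = ℕP.≤-refl ∷ replicate-++-sorted (suc k) below sorted

replicate-++-injective : ∀ a b {x xs ys} → All (_< x) xs → All (_< x) ys →
                         L.replicate a x ++ xs ≡ L.replicate b x ++ ys → a ≡ b × xs ≡ ys
replicate-++-injective zero    zero    _           _           eq = refl , eq
replicate-++-injective zero    (suc b) (y<x ∷ _)   _           eq = contradiction (proj₁ (LP.∷-injective eq)) (ℕP.<⇒≢ y<x)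
replicate-++-injective (suc a) zero    _           (y<x ∷ _)   eq = contradiction (sym (proj₁ (LP.∷-injective eq))) (ℕP.<⇒≢ y<x)
replicate-++-injective (suc a) (suc b) below₁      below₂      eq =
  Product.map₁ (cong suc) (replicate-++-injective a b below₁ below₂ (proj₂ (LP.∷-injective eq)))

sorted-split : ∀ x xs → Linked ℕ._≥_ xs → All (_≤ x) xs →
               ∃₂ λ k ys → xs ≡ L.replicate k x ++ ys × All (_< x) ys × Linked ℕ._≥_ ys
sorted-split x []       _      _            = 0 , [] , refl , [] , []
sorted-split x (y ∷ xs) sorted (y≤x ∷ xs≤x) with y ℕ.≟ x
... | yes refl =
  let k , ys , xs≡ , ys<x , ys-sorted = sorted-split x xs (Linked.tail sorted) xs≤x
  in  suc k , ys , cong (y ∷_) xs≡ , ys<x , ys-sorted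
... | no y≢x = 0 , y ∷ xs , refl , All.map (λ p≤y → ℕP.≤-<-trans p≤y y<x) (Linked⇒All ≥-trans ℕP.≤-refl sorted) , sorted
  where
  y<x = ℕP.≤∧≢⇒< y≤x y≢x
  ≥-trans : ∀ {a b c} → a ℕ.≥ b → b ℕ.≥ c → a ℕ.≥ c
  ≥-trans a≥b b≥c = ℕP.≤-trans b≥c a≥b

tabulate-∷ʳ : ∀ {A : Set} {n} (f : Fin (suc n) → A) → L.tabulate f ≡ L.tabulate (f ∘ inject₁) L.∷ʳ f (fromℕ n)
tabulate-∷ʳ {n = zero}  f = refl
tabulate-∷ʳ {n = suc n} f = cong (f zero ∷_) (tabulate-∷ʳ (f ∘ suc))

punchIn-fromℕ : ∀ {n} (i : Fin n) → punchIn (fromℕ n) i ≡ inject₁ i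
punchIn-fromℕ zero    = refl
punchIn-fromℕ (suc i) = cong suc (punchIn-fromℕ i)

≗-by-init-last : ∀ {A : Set} {n} {c d : Fin (suc n) → A} →
                 (∀ i → c (inject₁ i) ≡ d (inject₁ i)) → c (fromℕ n) ≡ d (fromℕ n) → ∀ i → c i ≡ d i
≗-by-init-last {n = zero}  _    last≡ zero    = last≡
≗-by-init-last {n = suc n} init≡ _    zero    = init≡ zero
≗-by-init-last {n = suc n} init≡ last≡ (suc i) = ≗-by-init-last (init≡ ∘ suc) last≡ i

block : ∀ {n} → ℕ → (Fin n → ℕ) → Fin n → List ℕ
block m c i = L.replicate (c i) (m ℕ.+ toℕ i)

partOf-concat : ∀ t m c → partOf t m c ≡ L.concat (L.reverse (L.tabulate (block m c)))
partOf-concat t m c =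
  cong L.concat (trans (LP.reverse-map (block m c) (L.allFin (suc t))) (cong L.reverse (LP.map-tabulate id (block m c))))

partOf-suc : ∀ n m c → partOf (suc n) m c ≡ L.replicate (c (fromℕ (suc n))) (m ℕ.+ suc n) ++ partOf n m (c ∘ inject₁)
partOf-suc n m c = begin
  partOf (suc n) m c                                                          ≡⟨ partOf-concat (suc n) m c ⟩
  L.concat (L.reverse (L.tabulate (block m c)))                               ≡⟨ cong (L.concat ∘ L.reverse) (tabulate-∷ʳ (block m c)) ⟩
  L.concat (L.reverse (L.tabulate (block m c ∘ inject₁) L.∷ʳ block m c last)) ≡⟨ cong L.concat (LP.reverse-++ (L.tabulate (block m c ∘ inject₁)) [ block m c last ]) ⟩
  block m c last ++ L.concat (L.reverse (L.tabulate (block m c ∘ inject₁)))   ≡⟨ cong₂ (λ a xs → L.replicate (c last) (m ℕ.+ a) ++ L.concat (L.reverse xs))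
                                                                                       (FinP.toℕ-fromℕ (suc n)) (LP.tabulate-cong lower) ⟩
  L.replicate (c last) (m ℕ.+ suc n) ++ L.concat (L.reverse (L.tabulate (block m (c ∘ inject₁))))
                                                                              ≡⟨ cong (L.replicate (c last) (m ℕ.+ suc n) ++_) (partOf-concat n m (c ∘ inject₁)) ⟨
  L.replicate (c last) (m ℕ.+ suc n) ++ partOf n m (c ∘ inject₁)              ∎
  where
  open ≡-Reasoning
  last = fromℕ (suc n)
  lower : ∀ i → block m c (inject₁ i) ≡ block m (c ∘ inject₁) i
  lower i = cong (λ a → L.replicate (c (inject₁ i)) (m ℕ.+ a)) (FinP.toℕ-inject₁ i)

partOf-cong : ∀ n m {c d} → (∀ i → c i ≡ d i) → partOf n m c ≡ partOf n m d
partOf-cong n m c≗d = LP.concatMap-cong (λ i → cong (λ k → L.replicate k (m ℕ.+ toℕ i)) (c≗d i)) (L.reverse (L.allFin (suc n)))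

InRange : ℕ → ℕ → ℕ → Set
InRange m n p = m ≤ p × p ≤ m ℕ.+ n

partOf-bounded : ∀ n m c → All (InRange m n) (partOf n m c)
partOf-bounded zero    m c = AllP.++⁺ (AllP.replicate⁺ (c zero) (ℕP.m≤m+n m 0 , ℕP.≤-refl)) []
partOf-bounded (suc n) m c rewrite partOf-suc n m c =
  AllP.++⁺ (AllP.replicate⁺ _ (ℕP.m≤m+n m (suc n) , ℕP.≤-refl))
           (All.map (Product.map₂ (λ p≤ → ℕP.≤-trans p≤ (ℕP.+-monoʳ-≤ m (ℕP.n≤1+n n)))) (partOf-bounded n m (c ∘ inject₁)))

partOf-<-top : ∀ n m c → All (_< m ℕ.+ suc n) (partOf n m c)
partOf-<-top n m c = All.map (λ (_ , p≤) → ℕP.≤-<-trans p≤ (ℕP.+-monoʳ-< m (ℕP.n<1+n n))) (partOf-bounded n m c)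

partOf-sorted : ∀ n m c → Linked ℕ._≥_ (partOf n m c)
partOf-sorted zero    m c = replicate-++-sorted (c zero) [] []
partOf-sorted (suc n) m c rewrite partOf-suc n m c =
  replicate-++-sorted _ (All.map ℕP.<⇒≤ (partOf-<-top n m (c ∘ inject₁))) (partOf-sorted n m (c ∘ inject₁))

∈-partOf⁺ : ∀ n m c → 1 ≤ c zero → m ∈ partOf n m c
∈-partOf⁺ zero    m c c₀≥1 with c zero | c₀≥1
... | suc _ | _ = here (sym (ℕP.+-identityʳ m))
∈-partOf⁺ (suc n) m c c₀≥1 rewrite partOf-suc n m c = ∈-++⁺ʳ _ (∈-partOf⁺ n m (c ∘ inject₁) c₀≥1)

∈-partOf⁻ : ∀ n m c → m ∈ partOf n m c → 1 ≤ c zero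
∈-partOf⁻ zero    m c m∈ with c zero
∈-partOf⁻ zero    m c () | zero
∈-partOf⁻ zero    m c m∈ | suc _ = s≤s z≤n
∈-partOf⁻ (suc n) m c m∈ rewrite partOf-suc n m c with ∈-++⁻ (L.replicate (c (fromℕ (suc n))) (m ℕ.+ suc n)) m∈
... | inj₁ m∈top  = contradiction (trans (∈-replicate⁻ (c (fromℕ (suc n))) m∈top) (ℕP.+-suc m n)) (ℕP.m≢1+m+n m)
... | inj₂ m∈rest = ∈-partOf⁻ n m (c ∘ inject₁) m∈rest

partOf-injective : ∀ n m c d → partOf n m c ≡ partOf n m d → ∀ i → c i ≡ d i
partOf-injective zero    m c d eq zero = proj₁ (replicate-++-injective (c zero) (d zero) [] [] eq)
partOf-injective (suc n) m c d eq =
  ≗-by-init-last (partOf-injective n m (c ∘ inject₁) (d ∘ inject₁) lower≡) top≡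
  where
  split = replicate-++-injective (c (fromℕ (suc n))) (d (fromℕ (suc n)))
            (partOf-<-top n m (c ∘ inject₁)) (partOf-<-top n m (d ∘ inject₁))
            (trans (sym (partOf-suc n m c)) (trans eq (partOf-suc n m d)))
  top≡ = proj₁ split
  lower≡ = proj₂ split

partOf-surjective : ∀ n m xs → Linked ℕ._≥_ xs → All (InRange m n) xs → ∃ λ c → partOf n m c ≡ xs
partOf-surjective zero    m xs sorted xs-in with sorted-split (m ℕ.+ 0) xs sorted (All.map proj₂ xs-in)
... | k , []    , xs≡ , _       , _ = (λ _ → k) , sym xs≡
... | k , p ∷ _ , xs≡ , p<m+0 ∷ _ , _ with AllP.++⁻ʳ (L.replicate k (m ℕ.+ 0)) (subst (All (InRange m 0)) xs≡ xs-in)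
...   | (m≤p , _) ∷ _ = contradiction m≤p (ℕP.<⇒≱ (subst (p <_) (ℕP.+-identityʳ m) p<m+0))
partOf-surjective (suc n) m xs sorted xs-in with sorted-split (m ℕ.+ suc n) xs sorted (All.map proj₂ xs-in)
... | k , ys , xs≡ , ys<top , ys-sorted
    with partOf-surjective n m ys ys-sorted (All.zipWith (λ {p} ((m≤p , _) , p<top) → m≤p , ℕP.≤-pred (subst (p <_) (ℕP.+-suc m n) p<top))
                                                         (AllP.++⁻ʳ (L.replicate k (m ℕ.+ suc n)) (subst (All (InRange m (suc n))) xs≡ xs-in) , ys<top))
... | c′ , c′≡ = c , (begin
  partOf (suc n) m c                                            ≡⟨ partOf-suc n m c ⟩
  L.replicate (c (fromℕ (suc n))) (m ℕ.+ suc n) ++ partOf n m (c ∘ inject₁)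
                                                                ≡⟨ cong₂ (λ a xs → L.replicate a (m ℕ.+ suc n) ++ xs)
                                                                         (VFP.insertAt-lookup c′ (fromℕ (suc n)) k) (trans (partOf-cong n m lower) c′≡) ⟩
  L.replicate k (m ℕ.+ suc n) ++ ys                             ≡⟨ xs≡ ⟨
  xs                                                            ∎)
  where
  open ≡-Reasoning
  c = VF.insertAt c′ (fromℕ (suc n)) k
  lower : ∀ i → c (inject₁ i) ≡ c′ i
  lower i = trans (cong c (sym (punchIn-fromℕ i))) (VFP.insertAt-punchIn c′ (fromℕ (suc n)) k i)

sum-partOf : ∀ n m c → sum (partOf n m c) ≡ ℕΣ.sum (λ i → c i ℕ.* (m ℕ.+ toℕ i))
sum-partOf zero    m c = trans (sum-++ (L.replicate (c zero) (m ℕ.+ 0)) []) (cong (ℕ._+ 0) (sum-replicate (c zero) (m ℕ.+ 0)))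
sum-partOf (suc n) m c = begin
  sum (partOf (suc n) m c)                                                   ≡⟨ cong sum (partOf-suc n m c) ⟩
  sum (L.replicate (c last) (m ℕ.+ suc n) ++ partOf n m (c ∘ inject₁))       ≡⟨ sum-++ (L.replicate (c last) (m ℕ.+ suc n)) _ ⟩
  sum (L.replicate (c last) (m ℕ.+ suc n)) ℕ.+ sum (partOf n m (c ∘ inject₁)) ≡⟨ cong₂ ℕ._+_ (sum-replicate (c last) (m ℕ.+ suc n)) (sum-partOf n m (c ∘ inject₁)) ⟩
  c last ℕ.* (m ℕ.+ suc n) ℕ.+ ℕΣ.sum (λ i → c (inject₁ i) ℕ.* (m ℕ.+ toℕ i)) ≡⟨ ℕP.+-comm (c last ℕ.* (m ℕ.+ suc n)) _ ⟩
  ℕΣ.sum (λ i → c (inject₁ i) ℕ.* (m ℕ.+ toℕ i)) ℕ.+ c last ℕ.* (m ℕ.+ suc n) ≡⟨ cong₂ ℕ._+_ (ℕΣ.sum-cong-≗ (λ i → cong (λ a → c (inject₁ i) ℕ.* (m ℕ.+ a)) (FinP.toℕ-inject₁ i)))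
                                                                                             (cong (λ a → c last ℕ.* (m ℕ.+ a)) (FinP.toℕ-fromℕ (suc n))) ⟨
  ℕΣ.sum (f ∘ inject₁) ℕ.+ f last                                            ≡⟨ ℕΣ.sum-init-last f ⟨
  ℕΣ.sum f                                                                   ∎
  where
  open ≡-Reasoning
  last = fromℕ (suc n)
  f : Fin (suc (suc n)) → ℕ
  f i = c i ℕ.* (m ℕ.+ toℕ i)

if-T : ∀ {A : Set} {b} {x y : A} → Bool.T b → (if b then x else y) ≡ x
if-T {b = true} _ = refl

if-¬T : ∀ {A : Set} {b} {x y : A} → ¬ Bool.T b → (if b then x else y) ≡ y
if-¬T {b = false} _  = refl
if-¬T {b = true}  ¬t = contradiction _ ¬t

𝟙[_≤_] : ℕ → ℕ → ℤ
𝟙[ a ≤ b ] = if a ℕ.≤ᵇ b then 1ℤ else 0ℤ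

𝟙-yes : ∀ {a b} → a ≤ b → 𝟙[ a ≤ b ] ≡ 1ℤ
𝟙-yes a≤b = if-T (ℕP.≤⇒≤ᵇ a≤b)

𝟙-no : ∀ {a b} → b < a → 𝟙[ a ≤ b ] ≡ 0ℤ
𝟙-no {a} {b} b<a = if-¬T (ℕP.<⇒≱ b<a ∘ ℕP.≤ᵇ⇒≤ a b)

𝟙-suc : ∀ a b → 𝟙[ suc a ≤ suc b ] ≡ 𝟙[ a ≤ b ]
𝟙-suc zero    b = refl
𝟙-suc (suc a) b = refl

sum-𝟙 : ∀ n ρ → ρ < n → ℤΣ.sum {n} (λ j → 𝟙[ toℕ j ≤ ρ ]) ≡ + suc ρ
sum-𝟙 (suc n) zero    _         = cong (ℤ._+_ 1ℤ) (ℤΣ.sum-replicate-zero n)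
sum-𝟙 (suc n) (suc ρ) (s≤s ρ<n) =
  cong (ℤ._+_ 1ℤ) (trans (ℤΣ.sum-cong-≗ {n} (λ j → 𝟙-suc (toℕ j) ρ)) (sum-𝟙 n ρ ρ<n))

module Vectors (t′ : ℕ) where
  t : ℕ
  t = suc t′

  T : ℤ
  T = + t

  v-low : ∀ n (j : Fin (suc t)) → toℕ j < t → v t n j ≡ 𝟙[ toℕ j ≤ (n ∸ 1) % t ]
  v-low n j j<t = if-T (ℕP.<⇒<ᵇ j<t)

  v-last : ∀ n → v t n (fromℕ t) ≡ + (t ℕ.* ((n ∸ 1) / t))
  v-last n = if-¬T (ℕP.<-irrefl (FinP.toℕ-fromℕ t) ∘ ℕP.<ᵇ⇒< _ t)

  sum-v : ∀ n → ℤΣ.sum (v t (suc n)) ≡ + suc n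
  sum-v n = begin
    ℤΣ.sum (v t (suc n))                                           ≡⟨ ℤΣ.sum-init-last (v t (suc n)) ⟩
    ℤΣ.sum (v t (suc n) ∘ inject₁) ℤ.+ v t (suc n) (fromℕ t)       ≡⟨ cong₂ ℤ._+_ (ℤΣ.sum-cong-≗ low) (v-last (suc n)) ⟩
    ℤΣ.sum {t} (λ j → 𝟙[ toℕ j ≤ n % t ]) ℤ.+ + (t ℕ.* (n / t))    ≡⟨ cong (ℤ._+ + (t ℕ.* (n / t))) (sum-𝟙 t (n % t) (m%n<n n t)) ⟩
    + (suc (n % t) ℕ.+ t ℕ.* (n / t))                              ≡⟨ cong (λ k → + suc (n % t ℕ.+ k)) (ℕP.*-comm t (n / t)) ⟩
    + suc (n % t ℕ.+ n / t ℕ.* t)                                  ≡⟨ cong (+_ ∘ suc) (m≡m%n+[m/n]*n n t) ⟨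
    + suc n                                                        ∎
    where
    open ≡-Reasoning
    low : ∀ (j : Fin t) → v t (suc n) (inject₁ j) ≡ 𝟙[ toℕ j ≤ n % t ]
    low j = trans (v-low (suc n) (inject₁ j) (subst (_< t) (sym (FinP.toℕ-inject₁ j)) (FinP.toℕ<n j)))
                  (cong 𝟙[_≤ n % t ] (FinP.toℕ-inject₁ j))

  -- Entry a of the first t coordinates, read as 0# for a ≥ t.
  lowEntry : {A : Set} → A → (Fin (suc t) → A) → ℕ → A
  lowEntry 0# y a with a ℕ.<? t
  ... | yes a<t = y (fromℕ< (ℕP.m<n⇒m<1+n a<t))
  ... | no _    = 0#

  lowEntry-v : ∀ n a → lowEntry 0ℤ (v t n) a ≡ 𝟙[ a ≤ (n ∸ 1) % t ]
  lowEntry-v n a with a ℕ.<? t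
  ... | yes a<t = trans (v-low n j (subst (_< t) (sym toℕ-j) a<t)) (cong 𝟙[_≤ (n ∸ 1) % t ] toℕ-j)
    where
    j = fromℕ< (ℕP.m<n⇒m<1+n a<t)
    toℕ-j = FinP.toℕ-fromℕ< (ℕP.m<n⇒m<1+n a<t)
  ... | no a≮t  = sym (𝟙-no (ℕP.<-≤-trans (m%n<n (n ∸ 1) t) (ℕP.≮⇒≥ a≮t)))

  toℚ-lowEntry : ∀ x a → lowEntry 0ℚ (toℚ ∘ x) a ≡ toℚ (lowEntry 0ℤ x a)
  toℚ-lowEntry x a with a ℕ.<? t
  ... | yes _ = refl
  ... | no _  = refl

  lowEntry-linear : ∀ a → Linear (λ y → lowEntry 0ℚ y a)
  linearity (lowEntry-linear a) {k} β w y y≡ with a ℕ.<? t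
  ... | yes _ = y≡ _
  ... | no _  = sym (trans (ℚΣ.sum-cong-≗ {k} (λ i → ℚP.*-zeroʳ (β i))) (ℚΣ.sum-replicate-zero k))

module DualBasis (t′ m′ : ℕ) where
  open Vectors t′

  m r q : ℕ
  m = suc m′
  r = m′ % t
  q = m′ / t

  record Functional : Set where
    constructor functional
    field
      a b : ℕ
      C   : ℤ

  -- On v_n the first term sees the residue (n - 1) % t, the second the carry (n - 1) / t - q.
  φℤ : Functional → (Fin (suc t) → ℤ) → ℤ
  φℤ (functional a b C) x =
    T ℤ.* (lowEntry 0ℤ x a ℤ.- lowEntry 0ℤ x b) ℤ.+ C ℤ.* (x (fromℕ t) ℤ.- T ℤ.* + q ℤ.* x zero)

  φℚ : Functional → (Fin (suc t) → ℚ) → ℚ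
  φℚ (functional a b C) y =
    toℚ T ℚ.* (lowEntry 0ℚ y a ℚ.- lowEntry 0ℚ y b) ℚ.+ toℚ C ℚ.* (y (fromℕ t) ℚ.- toℚ (T ℤ.* + q) ℚ.* y zero)

  φℚ-linear : ∀ F → Linear (φℚ F)
  φℚ-linear (functional a b C) = +-linear low-linear last-linear
    where
    low-linear : Linear (λ y → toℚ T ℚ.* (lowEntry 0ℚ y a ℚ.- lowEntry 0ℚ y b))
    low-linear = *-linear (toℚ T) (sub-linear (lowEntry-linear a) (lowEntry-linear b))
    last-linear : Linear (λ y → toℚ C ℚ.* (y (fromℕ t) ℚ.- toℚ (T ℤ.* + q) ℚ.* y zero))
    last-linear = *-linear (toℚ C) (sub-linear (coordinate-linear (fromℕ t)) (*-linear (toℚ (T ℤ.* + q)) (coordinate-linear zero)))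

  toℚ-φ : ∀ F x → φℚ F (toℚ ∘ x) ≡ toℚ (φℤ F x)
  toℚ-φ (functional a b C) x = sym (begin
    toℚ (T ℤ.* (xa ℤ.- xb) ℤ.+ C ℤ.* (xₜ ℤ.- Tq ℤ.* x₀))
      ≡⟨ toℚ-+ (T ℤ.* (xa ℤ.- xb)) _ ⟩
    toℚ (T ℤ.* (xa ℤ.- xb)) ℚ.+ toℚ (C ℤ.* (xₜ ℤ.- Tq ℤ.* x₀))
      ≡⟨ cong₂ ℚ._+_ (toℚ-* T (xa ℤ.- xb)) (toℚ-* C (xₜ ℤ.- Tq ℤ.* x₀)) ⟩
    toℚ T ℚ.* toℚ (xa ℤ.- xb) ℚ.+ toℚ C ℚ.* toℚ (xₜ ℤ.- Tq ℤ.* x₀)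
      ≡⟨ cong₂ (λ p p′ → toℚ T ℚ.* p ℚ.+ toℚ C ℚ.* p′) (toℚ-- xa xb) (trans (toℚ-- xₜ (Tq ℤ.* x₀)) (cong (ℚ._-_ (toℚ xₜ)) (toℚ-* Tq x₀))) ⟩
    toℚ T ℚ.* (toℚ xa ℚ.- toℚ xb) ℚ.+ toℚ C ℚ.* (toℚ xₜ ℚ.- toℚ Tq ℚ.* toℚ x₀)
      ≡⟨ cong₂ (λ p p′ → toℚ T ℚ.* (p ℚ.- p′) ℚ.+ toℚ C ℚ.* (toℚ xₜ ℚ.- toℚ Tq ℚ.* toℚ x₀)) (toℚ-lowEntry x a) (toℚ-lowEntry x b) ⟨
    φℚ (functional a b C) (toℚ ∘ x) ∎)
    where
    open ≡-Reasoning
    xa = lowEntry 0ℤ x a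
    xb = lowEntry 0ℤ x b
    xₜ = x (fromℕ t)
    x₀ = x zero
    Tq = T ℤ.* + q

  φ/t : Functional → ℕ → ℕ → ℤ
  φ/t (functional a b C) ρ s = 𝟙[ a ≤ ρ ] ℤ.- 𝟙[ b ≤ ρ ] ℤ.+ C ℤ.* + s

  φℤ-v : ∀ F n s → n / t ≡ q ℕ.+ s → φℤ F (v t (suc n)) ≡ T ℤ.* φ/t F (n % t) s
  φℤ-v (functional a b C) n s n/t≡ = begin
    T ℤ.* (lowEntry 0ℤ (v t (suc n)) a ℤ.- lowEntry 0ℤ (v t (suc n)) b) ℤ.+ C ℤ.* (v t (suc n) (fromℕ t) ℤ.- T ℤ.* + q ℤ.* 1ℤ)
      ≡⟨ cong₂ (λ d e → T ℤ.* d ℤ.+ C ℤ.* (e ℤ.- T ℤ.* + q ℤ.* 1ℤ))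
               (cong₂ ℤ._-_ (lowEntry-v (suc n) a) (lowEntry-v (suc n) b)) (trans (v-last (suc n)) last≡) ⟩
    T ℤ.* (𝟙[ a ≤ n % t ] ℤ.- 𝟙[ b ≤ n % t ]) ℤ.+ C ℤ.* (T ℤ.* (+ q ℤ.+ + s) ℤ.- T ℤ.* + q ℤ.* 1ℤ)
      ≡⟨ ring T (𝟙[ a ≤ n % t ] ℤ.- 𝟙[ b ≤ n % t ]) C (+ q) (+ s) ⟩
    T ℤ.* (𝟙[ a ≤ n % t ] ℤ.- 𝟙[ b ≤ n % t ] ℤ.+ C ℤ.* + s) ∎
    where
    open ≡-Reasoning
    last≡ : + (t ℕ.* (n / t)) ≡ T ℤ.* (+ q ℤ.+ + s)
    last≡ = trans (cong (λ k → + (t ℕ.* k)) n/t≡) (trans (ℤP.pos-* t (q ℕ.+ s)) (cong (T ℤ.*_) (ℤP.pos-+ q s)))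
    ring : ∀ T A C Q S → T ℤ.* A ℤ.+ C ℤ.* (T ℤ.* (Q ℤ.+ S) ℤ.- T ℤ.* Q ℤ.* 1ℤ) ≡ T ℤ.* (A ℤ.+ C ℤ.* S)
    ring = solve-∀

  φℤ-Λ : ∀ F x → InΛ t x → ∃ λ z → φℤ F x ≡ T ℤ.* z
  φℤ-Λ (functional a b C) x Λx with ℤ∣.∣ᵤ⇒∣ {T} {x (fromℕ t)} Λx
  ... | ℤ∣.divides κ xₜ≡ = lowEntry 0ℤ x a ℤ.- lowEntry 0ℤ x b ℤ.+ C ℤ.* (κ ℤ.- + q ℤ.* x zero) ,
    trans (cong (λ e → T ℤ.* (lowEntry 0ℤ x a ℤ.- lowEntry 0ℤ x b) ℤ.+ C ℤ.* (e ℤ.- T ℤ.* + q ℤ.* x zero)) xₜ≡)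
          (ring T (lowEntry 0ℤ x a ℤ.- lowEntry 0ℤ x b) C κ (+ q) (x zero))
    where
    ring : ∀ T A C K Q X → T ℤ.* A ℤ.+ C ℤ.* (K ℤ.* T ℤ.- T ℤ.* Q ℤ.* X) ≡ T ℤ.* (A ℤ.+ C ℤ.* (K ℤ.- Q ℤ.* X))
    ring = solve-∀

  r<t : r < t
  r<t = m%n<n m′ t

  -- v_{m+k} = (b_{ρ-at k}, t ⌊(m - 1 + k) / t⌋)
  ρ-at : ℕ → ℕ
  ρ-at k = (m′ ℕ.+ k) % t

  φℤ-at : ∀ F k z → k ≤ t →
          (ρ-at k ≡ r ℕ.+ k → φ/t F (ρ-at k) 0 ≡ z) →
          (ρ-at k ℕ.+ t ≡ r ℕ.+ k → φ/t F (ρ-at k) 1 ≡ z) →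
          φℤ F (v t (m ℕ.+ k)) ≡ T ℤ.* z
  φℤ-at F k z k≤t if-stays if-wraps with shift m′ k t k≤t
  ... | stays ρ≡ Q≡ = trans (φℤ-v F (m′ ℕ.+ k) 0 (trans Q≡ (sym (ℕP.+-identityʳ q)))) (cong (T ℤ.*_) (if-stays ρ≡))
  ... | wraps ρ≡ Q≡ = trans (φℤ-v F (m′ ℕ.+ k) 1 (trans Q≡ (ℕP.+-comm 1 q))) (cong (T ℤ.*_) (if-wraps ρ≡))

  wraps⇒≤ : ∀ {k ρ} → k ≤ t → ρ ℕ.+ t ≡ r ℕ.+ k → ρ ≤ r
  wraps⇒≤ {k} k≤t eq = ℕP.+-cancelʳ-≤ t _ r (subst (_≤ r ℕ.+ t) (sym eq) (ℕP.+-monoʳ-≤ r k≤t))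

  wraps⇒< : ∀ {k ρ} → k < t → ρ ℕ.+ t ≡ r ℕ.+ k → ρ < r
  wraps⇒< {k} k<t eq = ℕP.+-cancelʳ-< t _ r (subst (_< r ℕ.+ t) (sym eq) (ℕP.+-monoʳ-< r k<t))

  record Dual (i : ℕ) : Set where
    field
      F    : Functional
      hit  : φℤ F (v t (m ℕ.+ i)) ≡ T
      miss : ∀ k → k ≤ t → k ≢ i → φℤ F (v t (m ℕ.+ k)) ≡ 0ℤ

  φℤ-at≡T : ∀ F i → i ≤ t → (ρ-at i ≡ r ℕ.+ i → φ/t F (ρ-at i) 0 ≡ 1ℤ) →
           (ρ-at i ℕ.+ t ≡ r ℕ.+ i → φ/t F (ρ-at i) 1 ≡ 1ℤ) → φℤ F (v t (m ℕ.+ i)) ≡ T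
  φℤ-at≡T F i i≤t if-stays if-wraps = trans (φℤ-at F i 1ℤ i≤t if-stays if-wraps) (ℤP.*-identityʳ T)

  φℤ-at≡0 : ∀ F k → k ≤ t → (ρ-at k ≡ r ℕ.+ k → φ/t F (ρ-at k) 0 ≡ 0ℤ) →
            (ρ-at k ℕ.+ t ≡ r ℕ.+ k → φ/t F (ρ-at k) 1 ≡ 0ℤ) → φℤ F (v t (m ℕ.+ k)) ≡ 0ℤ
  φℤ-at≡0 F k k≤t if-stays if-wraps = trans (φℤ-at F k 0ℤ k≤t if-stays if-wraps) (ℤP.*-zeroʳ T)

  dual-first : Dual 0
  dual-first = record
    { F    = F₀
    ; hit  = φℤ-at≡T F₀ 0 z≤n stays-hit wraps-hit
    ; miss = λ k k≤t k≢0 → φℤ-at≡0 F₀ k k≤t (stays-miss (ℕP.n≢0⇒n>0 k≢0)) (wraps-miss k≤t)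
    }
    where
    F₀ = functional 0 (suc r) -1ℤ
    stays-hit : ρ-at 0 ≡ r ℕ.+ 0 → φ/t F₀ (ρ-at 0) 0 ≡ 1ℤ
    stays-hit ρ≡ rewrite ρ≡ | 𝟙-no {suc r} {r ℕ.+ 0} (s≤s (ℕP.≤-reflexive (ℕP.+-identityʳ r))) = refl
    wraps-hit : ρ-at 0 ℕ.+ t ≡ r ℕ.+ 0 → φ/t F₀ (ρ-at 0) 1 ≡ 1ℤ
    wraps-hit eq = contradiction (ℕP.m≤n+m t (ρ-at 0)) (ℕP.<⇒≱ (subst (_< t) (trans (sym (ℕP.+-identityʳ r)) (sym eq)) r<t))
    stays-miss : ∀ {k} → 0 < k → ρ-at k ≡ r ℕ.+ k → φ/t F₀ (ρ-at k) 0 ≡ 0ℤ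
    stays-miss {k} 0<k ρ≡ rewrite ρ≡ | 𝟙-yes (subst (_≤ r ℕ.+ k) (ℕP.+-comm r 1) (ℕP.+-monoʳ-≤ r 0<k)) = refl
    wraps-miss : ∀ {k} → k ≤ t → ρ-at k ℕ.+ t ≡ r ℕ.+ k → φ/t F₀ (ρ-at k) 1 ≡ 0ℤ
    wraps-miss k≤t eq rewrite 𝟙-no (s≤s (wraps⇒≤ k≤t eq)) = refl

  dual-last : Dual t
  dual-last = record
    { F    = Fₜ
    ; hit  = φℤ-at≡T Fₜ t ℕP.≤-refl stays-hit wraps-hit
    ; miss = λ k k≤t k≢t → φℤ-at≡0 Fₜ k k≤t stays-miss (wraps-miss (ℕP.≤∧≢⇒< k≤t k≢t))
    }
    where
    Fₜ = functional r 0 1ℤ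
    stays-hit : ρ-at t ≡ r ℕ.+ t → φ/t Fₜ (ρ-at t) 0 ≡ 1ℤ
    stays-hit eq = contradiction (subst (_< t) eq (m%n<n (m′ ℕ.+ t) t)) (ℕP.≤⇒≯ (ℕP.m≤n+m t r))
    wraps-hit : ρ-at t ℕ.+ t ≡ r ℕ.+ t → φ/t Fₜ (ρ-at t) 1 ≡ 1ℤ
    wraps-hit eq rewrite ℕP.+-cancelʳ-≡ t (ρ-at t) r eq | 𝟙-yes (ℕP.≤-refl {r}) = refl
    stays-miss : ∀ {k} → ρ-at k ≡ r ℕ.+ k → φ/t Fₜ (ρ-at k) 0 ≡ 0ℤ
    stays-miss {k} ρ≡ rewrite ρ≡ | 𝟙-yes (ℕP.m≤m+n r k) = refl
    wraps-miss : ∀ {k} → k < t → ρ-at k ℕ.+ t ≡ r ℕ.+ k → φ/t Fₜ (ρ-at k) 1 ≡ 0ℤ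
    wraps-miss k<t eq rewrite 𝟙-no (wraps⇒< k<t eq) = refl

  ρ-at-injective : ∀ {i k} → 0 < i → i < t → k ≤ t → ρ-at k ≡ ρ-at i → k ≡ i
  ρ-at-injective {i} {k} 0<i i<t k≤t ρₖ≡ρᵢ with shift m′ k t k≤t | shift m′ i t (ℕP.<⇒≤ i<t)
  ... | stays ρₖ≡ _ | stays ρᵢ≡ _ = ℕP.+-cancelˡ-≡ r k i (trans (sym ρₖ≡) (trans ρₖ≡ρᵢ ρᵢ≡))
  ... | wraps ρₖ≡ _ | wraps ρᵢ≡ _ = ℕP.+-cancelˡ-≡ r k i (trans (sym ρₖ≡) (trans (cong (ℕ._+ t) ρₖ≡ρᵢ) ρᵢ≡))
  ... | stays ρₖ≡ _ | wraps ρᵢ≡ _ = contradiction (ℕP.≤-trans (ℕP.m≤n+m t k) (ℕP.≤-reflexive k+t≡i)) (ℕP.<⇒≱ i<t)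
    where
    k+t≡i : k ℕ.+ t ≡ i
    k+t≡i = ℕP.+-cancelˡ-≡ r _ i (trans (sym (ℕP.+-assoc r k t)) (trans (cong (ℕ._+ t) (trans (sym ρₖ≡) ρₖ≡ρᵢ)) ρᵢ≡))
  ... | wraps ρₖ≡ _ | stays ρᵢ≡ _ = contradiction (ℕP.≤-trans (ℕP.+-monoˡ-≤ t 0<i) (ℕP.≤-reflexive i+t≡k)) (ℕP.<⇒≱ (s≤s k≤t))
    where
    i+t≡k : i ℕ.+ t ≡ k
    i+t≡k = ℕP.+-cancelˡ-≡ r _ k (trans (sym (ℕP.+-assoc r i t)) (trans (cong (ℕ._+ t) (trans (sym ρᵢ≡) (sym ρₖ≡ρᵢ))) ρₖ≡))

  dual-middle : ∀ {i} → 0 < i → i < t → Dual i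
  dual-middle {i} 0<i i<t = record
    { F    = Fᵢ
    ; hit  = φℤ-at≡T Fᵢ i (ℕP.<⇒≤ i<t) (λ _ → at-ρᵢ 0) (λ _ → at-ρᵢ 1)
    ; miss = λ k k≤t k≢i → φℤ-at≡0 Fᵢ k k≤t (λ _ → off-ρᵢ 0 (k≢i ∘ ρ-at-injective 0<i i<t k≤t))
                                           (λ _ → off-ρᵢ 1 (k≢i ∘ ρ-at-injective 0<i i<t k≤t))
    }
    where
    Fᵢ = functional (ρ-at i) (suc (ρ-at i)) 0ℤ
    at-ρᵢ : ∀ s → φ/t Fᵢ (ρ-at i) s ≡ 1ℤ
    at-ρᵢ _ rewrite 𝟙-yes (ℕP.≤-refl {ρ-at i}) | 𝟙-no (ℕP.n<1+n (ρ-at i)) = refl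
    off-ρᵢ : ∀ {ρ} s → ρ ≢ ρ-at i → φ/t Fᵢ ρ s ≡ 0ℤ
    off-ρᵢ {ρ} _ ρ≢ρᵢ with ℕP.<-cmp ρ (ρ-at i)
    ... | tri< ρ<ρᵢ _ _ rewrite 𝟙-no ρ<ρᵢ | 𝟙-no (ℕP.m<n⇒m<1+n ρ<ρᵢ) = refl
    ... | tri≈ _ ρ≡ρᵢ _ = contradiction ρ≡ρᵢ ρ≢ρᵢ
    ... | tri> _ _ ρᵢ<ρ rewrite 𝟙-yes (ℕP.<⇒≤ ρᵢ<ρ) | 𝟙-yes ρᵢ<ρ = refl

  -- Only v_m and v_{m+t} share a residue (namely r); the carry in the last coordinate
  -- separates them, while every other v_{m+k} is isolated by its residue alone.
  dual : ∀ i → i ≤ t → Dual i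
  dual zero    _   = dual-first
  dual (suc i) i<t with ℕP.m≤n⇒m<n∨m≡n i<t
  ... | inj₁ i<t′ = dual-middle (s≤s z≤n) i<t′
  ... | inj₂ refl = dual-last

  dual-at : (i : Fin (suc t)) → Dual (toℕ i)
  dual-at i = dual (toℕ i) (FinP.toℕ≤pred[n] i)

  IsℚCombination : (Fin (suc t) → ℚ) → (Fin (suc t) → ℚ) → Set
  IsℚCombination y β = ∀ j → y j ≡ Σℚ (λ i → β i ℚ.* toℚ (v t (m ℕ.+ toℕ i) j))

  dual-reads-coefficient : ∀ y β → IsℚCombination y β → ∀ i → φℚ (Dual.F (dual-at i)) y ≡ β i ℚ.* toℚ T
  dual-reads-coefficient y β rep i = begin
    φℚ F y                                             ≡⟨ linearity (φℚ-linear F) β W y (λ j → trans (rep j) (Σℚ≡sum (λ k → β k ℚ.* W k j))) ⟩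
    ℚΣ.sum (λ k → β k ℚ.* φℚ F (W k))                  ≡⟨ ℚΣ.sum-cong-≗ (λ k → cong (β k ℚ.*_) (toℚ-φ F (v t (m ℕ.+ toℕ k)))) ⟩
    ℚΣ.sum (λ k → β k ℚ.* toℚ (φℤ F (v t (m ℕ.+ toℕ k)))) ≡⟨ sum-supported-at (λ k → β k ℚ.* toℚ (φℤ F (v t (m ℕ.+ toℕ k)))) i off-i ⟩
    β i ℚ.* toℚ (φℤ F (v t (m ℕ.+ toℕ i)))             ≡⟨ cong (λ z → β i ℚ.* toℚ z) (Dual.hit (dual-at i)) ⟩
    β i ℚ.* toℚ T                                      ∎
    where
    open ≡-Reasoning
    F = Dual.F (dual-at i)
    W : Fin (suc t) → Fin (suc t) → ℚ
    W k = toℚ ∘ v t (m ℕ.+ toℕ k)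
    off-i : ∀ k → k ≢ i → β k ℚ.* toℚ (φℤ F (v t (m ℕ.+ toℕ k))) ≡ 0ℚ
    off-i k k≢i = trans (cong (λ z → β k ℚ.* toℚ z) (Dual.miss (dual-at i) (toℕ k) (FinP.toℕ≤pred[n] k) (k≢i ∘ FinP.toℕ-injective)))
                        (ℚP.*-zeroʳ (β k))

  coefficients-unique : ∀ {y} β β′ → IsℚCombination y β → IsℚCombination y β′ → ∀ i → β i ≡ β′ i
  coefficients-unique {y} β β′ rep rep′ i = toℚ-*-cancelʳ t′ (trans (sym (dual-reads-coefficient y β rep i)) (dual-reads-coefficient y β′ rep′ i))

  coefficients-integral : ∀ x β → InΛ t x → IsℚCombination (toℚ ∘ x) β → ∀ i → ∃ λ z → β i ≡ toℚ z
  coefficients-integral x β Λx rep i with φℤ-Λ (Dual.F (dual-at i)) x Λx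
  ... | z , φ≡ = z , toℚ-*-cancelʳ t′ (begin
    β i ℚ.* toℚ T                     ≡⟨ dual-reads-coefficient (toℚ ∘ x) β rep i ⟨
    φℚ (Dual.F (dual-at i)) (toℚ ∘ x) ≡⟨ toℚ-φ (Dual.F (dual-at i)) x ⟩
    toℚ (φℤ (Dual.F (dual-at i)) x)   ≡⟨ cong toℚ φ≡ ⟩
    toℚ (T ℤ.* z)                     ≡⟨ toℚ-* T z ⟩
    toℚ T ℚ.* toℚ z                   ≡⟨ ℚP.*-comm (toℚ T) (toℚ z) ⟩
    toℚ z ℚ.* toℚ T                   ∎)
    where open ≡-Reasoning

  IsℤCombination : Pt t → (Fin (suc t) → ℤ) → Set
  IsℤCombination x z = ∀ j → x j ≡ Σℤ (λ i → z i ℤ.* v t (m ℕ.+ toℕ i) j)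

  toℚ-combination : ∀ {x} z → IsℤCombination x z → IsℚCombination (toℚ ∘ x) (toℚ ∘ z)
  toℚ-combination {x} z x≡ j = trans (cong toℚ (x≡ j)) (toℚ-Σ-* z (λ i → v t (m ℕ.+ toℕ i) j))

  toℚ-combination⁻ : ∀ {x} z → IsℚCombination (toℚ ∘ x) (toℚ ∘ z) → IsℤCombination x z
  toℚ-combination⁻ {x} z rep j = toℚ-injective (trans (rep j) (sym (toℚ-Σ-* z (λ i → v t (m ℕ.+ toℕ i) j))))

  partOf-height : ∀ {x c} → IsℤCombination x (+_ ∘ c) → + sum (partOf t m c) ≡ Σℤ x
  partOf-height {x} {c} x≡ = begin
    + sum (partOf t m c)                                          ≡⟨ cong +_ (sum-partOf t m c) ⟩
    + ℕΣ.sum (λ i → c i ℕ.* (m ℕ.+ toℕ i))                        ≡⟨ pos-sum (λ i → c i ℕ.* (m ℕ.+ toℕ i)) ⟩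
    ℤΣ.sum (λ i → + (c i ℕ.* (m ℕ.+ toℕ i)))                      ≡⟨ ℤΣ.sum-cong-≗ (λ i → trans (ℤP.pos-* (c i) (m ℕ.+ toℕ i)) (cong (+ c i ℤ.*_) (sym (sum-v (m′ ℕ.+ toℕ i))))) ⟩
    ℤΣ.sum (λ i → + c i ℤ.* ℤΣ.sum (v t (m ℕ.+ toℕ i)))           ≡⟨ ℤΣ.sum-cong-≗ (λ i → ℤΣ.*-distribˡ-sum (+ c i) (v t (m ℕ.+ toℕ i))) ⟩
    ℤΣ.sum (λ i → ℤΣ.sum (λ j → + c i ℤ.* v t (m ℕ.+ toℕ i) j))   ≡⟨ ℤΣ.∑-comm (λ i j → + c i ℤ.* v t (m ℕ.+ toℕ i) j) ⟩
    ℤΣ.sum (λ j → ℤΣ.sum (λ i → + c i ℤ.* v t (m ℕ.+ toℕ i) j))   ≡⟨ ℤΣ.sum-cong-≗ (λ j → trans (x≡ j) (Σℤ≡sum (λ i → + c i ℤ.* v t (m ℕ.+ toℕ i) j))) ⟨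
    ℤΣ.sum x                                                      ≡⟨ Σℤ≡sum x ⟨
    Σℤ x                                                          ∎
    where open ≡-Reasoning

  combination-∈Λ : ∀ (c : Fin (suc t) → ℕ) → InΛ t (λ j → Σℤ (λ i → + c i ℤ.* v t (m ℕ.+ toℕ i) j))
  combination-∈Λ c = ℤ∣.∣⇒∣ᵤ (Σℤ-∣ (λ i → + c i ℤ.* v t (m ℕ.+ toℕ i) (fromℕ t))
                                  (λ i → ℤ∣.∣n⇒∣m*n (+ c i) (subst (T ℤ∣.∣_) (sym (v-last (m ℕ.+ toℕ i))) (T∣ ((m′ ℕ.+ toℕ i) / t)))))
    where
    T∣ : ∀ Q → T ℤ∣.∣ + (t ℕ.* Q)
    T∣ Q = ℤ∣.divides (+ Q) (trans (ℤP.pos-* t Q) (ℤP.*-comm T (+ Q)))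

  integer-coefficients : (x : Pt t) → InΛ t x → InC t m x →
    Σ (Fin (suc t) → ℕ) λ c → IntRep t m x c × ((c′ : Fin (suc t) → ℕ) → IntRep t m x c′ → ∀ i → c i ≡ c′ i)
  integer-coefficients x Λx (α , α≥0 , α₀>0 , x≡α) = c , (c₀≥1 , toℚ-combination⁻ (+_ ∘ c) x≡c) , unique
    where
    z : Fin (suc t) → ℤ
    z i = proj₁ (coefficients-integral x α Λx x≡α i)
    c : Fin (suc t) → ℕ
    c i = ℤ.∣ z i ∣
    α≡c : ∀ i → α i ≡ toℚ (+ c i)
    α≡c i = trans α≡z (cong toℚ (sym (ℤP.0≤i⇒+∣i∣≡i (toℚ-nonNegative⁻ (z i) (subst (0ℚ ℚ.≤_) α≡z (α≥0 i))))))
      where α≡z = proj₂ (coefficients-integral x α Λx x≡α i)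
    x≡c : IsℚCombination (toℚ ∘ x) (λ i → toℚ (+ c i))
    x≡c j = trans (x≡α j) (Σℚ-cong (λ i → cong (ℚ._* toℚ (v t (m ℕ.+ toℕ i) j)) (α≡c i)))
    c₀≥1 : 1 ≤ c zero
    c₀≥1 = ℤP.drop‿+<+ (toℚ-positive⁻ (+ c zero) (subst (0ℚ ℚ.<_) (α≡c zero) α₀>0))
    unique : (c′ : Fin (suc t) → ℕ) → IntRep t m x c′ → ∀ i → c i ≡ c′ i
    unique c′ (_ , x≡c′) i =
      ℤP.+-injective (toℚ-injective (coefficients-unique (toℚ ∘ +_ ∘ c) (toℚ ∘ +_ ∘ c′) x≡c (toℚ-combination (+_ ∘ c′) x≡c′) i))

  partition-of-point : ∀ x c → IntRep t m x c → InCt t m (partOf t m c) × (+ ∣ partOf t m c ∣ₚ ≡ Σℤ x)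
  partition-of-point x c (c₀≥1 , x≡c) =
    ((All.map (ℕP.≤-trans (s≤s z≤n) ∘ proj₁) (partOf-bounded t m c) , partOf-sorted t m c) ,
     ∈-partOf⁺ t m c c₀≥1 , partOf-bounded t m c) ,
    partOf-height x≡c

  unique-preimage : (λ′ : List ℕ) → InCt t m λ′ →
    Σ (Pt t) λ x → (InΛ t x × InC t m x × Σ (Fin (suc t) → ℕ) λ c → IntRep t m x c × partOf t m c ≡ λ′)
      × ((y : Pt t) → InΛ t y → InC t m y → (d : Fin (suc t) → ℕ) → IntRep t m y d → partOf t m d ≡ λ′ → ∀ j → x j ≡ y j)
  unique-preimage λ′ ((_ , sorted) , m∈λ′ , λ′-bounded) with partOf-surjective t m λ′ sorted λ′-bounded
  ... | c , c↦λ′ = x , (combination-∈Λ c , x∈C , c , (c₀≥1 , λ _ → refl) , c↦λ′) , unique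
    where
    x : Pt t
    x j = Σℤ (λ i → + c i ℤ.* v t (m ℕ.+ toℕ i) j)
    c₀≥1 : 1 ≤ c zero
    c₀≥1 = ∈-partOf⁻ t m c (subst (m ∈_) (sym c↦λ′) m∈λ′)
    x∈C : InC t m x
    x∈C = toℚ ∘ +_ ∘ c , toℚ-nonNegative ∘ c , toℚ-positive c₀≥1 , toℚ-combination (+_ ∘ c) (λ _ → refl)
    unique : (y : Pt t) → InΛ t y → InC t m y → (d : Fin (suc t) → ℕ) → IntRep t m y d → partOf t m d ≡ λ′ → ∀ j → x j ≡ y j
    unique y _ _ d (_ , y≡d) d↦λ′ j =
      trans (Σℤ-cong (λ i → cong (λ k → + k ℤ.* v t (m ℕ.+ toℕ i) j) (partOf-injective t m c d (trans c↦λ′ (sym d↦λ′)) i)))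
            (sym (y≡d j))

lemma2 : (t : ℕ) → .{{_ : NonZero t}} → (m : ℕ) → 1 ≤ m →
    -- (1) unique integer coefficients
    ((x : Pt t) → InΛ t x → InC t m x →
      Σ (Fin (suc t) → ℕ) λ c → IntRep t m x c ×
        ((c′ : Fin (suc t) → ℕ) → IntRep t m x c′ → (i : Fin (suc t)) → c i ≡ c′ i))
    -- (2) f maps Λ ∩ C_m into C̃_m and is height-preserving
    × ((x : Pt t) (c : Fin (suc t) → ℕ) → InΛ t x → InC t m x → IntRep t m x c →
        InCt t m (partOf t m c) × (+ ∣ partOf t m c ∣ₚ ≡ Σℤ x))
    -- (3) every λ ∈ C̃_m has exactly one preimage under f
    × ((λ′ : List ℕ) → InCt t m λ′ →
        Σ (Pt t) λ x → (InΛ t x × InC t m x ×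
          Σ (Fin (suc t) → ℕ) λ c → IntRep t m x c × partOf t m c ≡ λ′)
        × ((y : Pt t) → InΛ t y → InC t m y →
            (d : Fin (suc t) → ℕ) → IntRep t m y d → partOf t m d ≡ λ′ →
            (j : Fin (suc t)) → x j ≡ y j))
lemma2 zero {{()}}
lemma2 (suc t′) zero ()
lemma2 (suc t′) (suc m′) _ =
  integer-coefficients , (λ x c _ _ → partition-of-point x c) , unique-preimage
  where open DualBasis t′ m′
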